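{- Let $G$ be a finite simple graph with $L(G)=2l(G)$. Then there do not exist two distinct vertices $u,v$ of degree one in $G$ that are adjacent to the same vertex $w$.
   Context: A matching is a set of pairwise non-adjacent edges; $\nu(G)$ is the maximum cardinality of a matching of $G$, and a matching is maximum if it has $\nu(G)$ edges. For $E'\subseteq E(G)$, $G\backslash E'$ is the graph obtained from $G$ by deleting the edges in $E'$ (keeping all vertices). Define $L(G)=\max\{\nu(G\backslash F): F \text{ a maximum matching of } G\}$ and $l(G)=\min\{\nu(G\backslash F): F \text{ a maximum matching of } G\}$. -}

module Defs where

open import Data.Nat using (ℕ; _≤_; _<_)
open import Data.Fin using (Fin; toℕ)
open import Data.Fin.Properties using (_≟_)
open import Data.Product using (Σ; ∃; _×_; _,_)
open import Data.Product.Properties using (≡-dec)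
open import Data.List using (List; length; filter; allFin)
open import Data.List.Relation.Unary.All using (All)
open import Data.List.Relation.Unary.AllPairs using (AllPairs)
open import Data.List.Membership.Propositional using (_∈_)
import Data.List.Membership.DecPropositional as DecMem
open import Relation.Nullary using (¬_; Dec; yes; no)
open import Relation.Nullary.Decidable using (_×-dec_; ¬?)
open import Relation.Binary.PropositionalEquality using (_≡_; _≢_)

record Graph (n : ℕ) : Set₁ where
  field
    Adj    : Fin n → Fin n → Set
    adj?   : ∀ i j → Dec (Adj i j)
    sym    : ∀ {i j} → Adj i j → Adj j i
    irrefl : ∀ i → ¬ Adj i i
open Graph public

-- An edge {i,j} is represented by the ordered pair (i , j) with i < j.
Edge : ℕ → Set
Edge n = Fin n × Fin n

IsEdge : ∀ {n} → Graph n → Edge n → Set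
IsEdge G (i , j) = (toℕ i < toℕ j) × Adj G i j

Disjoint : ∀ {n} → Edge n → Edge n → Set
Disjoint (a , b) (c , d) = (a ≢ c) × (a ≢ d) × (b ≢ c) × (b ≢ d)

-- A matching: a list of edges of G, pairwise without common endpoints
-- (hence in particular without repetitions). Its cardinality is its length.
IsMatching : ∀ {n} → Graph n → List (Edge n) → Set
IsMatching G M = All (IsEdge G) M × AllPairs Disjoint M

IsMaximumMatching : ∀ {n} → Graph n → List (Edge n) → Set
IsMaximumMatching G M =
  IsMatching G M × (∀ M' → IsMatching G M' → length M' ≤ length M)

HasMatchingNumber : ∀ {n} → Graph n → ℕ → Set
HasMatchingNumber G k = Σ _ λ M → IsMaximumMatching G M × length M ≡ k

module _ {n : ℕ} where
  open DecMem {A = Edge n} (≡-dec _≟_ _≟_) using (_∈?_)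

  deleteEdges : Graph n → List (Edge n) → Graph n
  deleteEdges G F = record
    { Adj    = λ i j → Adj G i j × ¬ ((i , j) ∈ F) × ¬ ((j , i) ∈ F)
    ; adj?   = λ i j → adj? G i j ×-dec (¬? ((i , j) ∈? F) ×-dec ¬? ((j , i) ∈? F))
    ; sym    = λ { (a , p , q) → sym G a , q , p }
    ; irrefl = λ i p → irrefl G i (Data.Product.proj₁ p)
    }
    where import Data.Product

  degree : Graph n → Fin n → ℕ
  degree G u = length (filter (adj? G u) (allFin n))

HasL : ∀ {n} → Graph n → ℕ → Set
HasL G a =
  (Σ _ λ F → IsMaximumMatching G F × HasMatchingNumber (deleteEdges G F) a)
  × (∀ F b → IsMaximumMatching G F → HasMatchingNumber (deleteEdges G F) b → b ≤ a)

Hasl : ∀ {n} → Graph n → ℕ → Set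
Hasl G a =
  (Σ _ λ F → IsMaximumMatching G F × HasMatchingNumber (deleteEdges G F) a)
  × (∀ F b → IsMaximumMatching G F → HasMatchingNumber (deleteEdges G F) b → a ≤ b)

-- Let F be a maximum matching realising l(G) = b, let F′ be one realising L(G), and let H be a
-- maximum matching of G \ F′. Splitting H along F gives
--   |H| = |H ∩ F| + |H ∖ F| ≤ |F ∖ F′| + b = |F′ ∖ F| + b ≤ 2b,
-- since H ∖ F and F′ ∖ F are matchings of G \ F, H ∩ F ⊆ F ∖ F′, and |F| = |F′|.
-- Now let u, v be pendant vertices at w. By maximality F covers w by some edge e, and one of
-- u, v, say p, is not an endpoint of e. For any matching Y of G through e, the edge pw can be
-- added to Y ∖ F inside G \ F, so |Y ∖ F| < b. Taking Y = F′, Y = H, or (if e lies in neither)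
-- noting e ∈ (F ∖ F′) ∖ (H ∩ F), one of the three inequalities above is strict, so L(G) < 2 l(G).
module Submission where

open import Defs hiding (sym)
open import Data.Nat using (ℕ; suc; _+_; _*_; _≤_; _<_; z≤n; s≤s)
open import Data.Nat.Properties
  using (≤-antisym; ≤-trans; <-≤-trans; ≤-<-trans; <-asym; <-irrefl; <-cmp; +-cancelˡ-≡;
         +-suc; +-identityʳ; +-mono-<-≤; +-mono-≤-<; module ≤-Reasoning)
open import Data.Fin using (Fin; toℕ)
open import Data.Fin.Properties using (_≟_; toℕ-injective)
open import Data.Product using (Σ; ∃; _×_; _,_; proj₁; proj₂)
open import Data.Product.Properties using (≡-dec)
open import Data.Empty using (⊥)
open import Data.Sum using (_⊎_; inj₁; inj₂)
open import Data.List using (List; []; _∷_; length; filter)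
open import Data.List.Properties using (length-removeAt′)
open import Data.List.Relation.Unary.All as All using (All; []; _∷_)
open import Data.List.Relation.Unary.All.Properties using (¬Any⇒All¬)
open import Data.List.Relation.Unary.Any using (Any; here; there; any?; index)
open import Data.List.Relation.Unary.AllPairs as AllPairs using (AllPairs; []; _∷_)
import Data.List.Relation.Unary.AllPairs.Properties as AllPairs
open import Data.List.Relation.Unary.Unique.Propositional using (Unique)
import Data.List.Relation.Unary.Unique.Propositional.Properties as Unique
open import Data.List.Relation.Binary.Subset.Propositional using (_⊆_)
open import Data.List.Membership.Propositional using (_∈_; _∉_; _─_; find; lose)
open import Data.List.Membership.Propositional.Properties using (∈-filter⁺; ∈-filter⁻; ∈-allFin)
import Data.List.Membership.DecPropositional as DecMembership
open import Relation.Nullary using (¬_; Dec; yes; no; contradiction)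
open import Relation.Nullary.Decidable using (_⊎-dec_)
open import Relation.Unary using (Pred; Decidable)
open import Relation.Unary.Properties using (∁?)
open import Relation.Binary using (DecidableEquality; tri<; tri≈; tri>)
open import Relation.Binary.PropositionalEquality
  using (_≡_; _≢_; refl; sym; trans; cong; subst; module ≡-Reasoning)

module _ {a} {A : Set a} where

  ∈-─⁺ : ∀ {x y : A} {ys} (x∈ys : x ∈ ys) → y ∈ ys → y ≢ x → y ∈ ys ─ x∈ys
  ∈-─⁺ (here refl)  (here refl)  y≢x = contradiction refl y≢x
  ∈-─⁺ (here refl)  (there y∈ys) _   = y∈ys
  ∈-─⁺ (there _)    (here refl)  _   = here refl
  ∈-─⁺ (there x∈ys) (there y∈ys) y≢x = there (∈-─⁺ x∈ys y∈ys y≢x)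

  Unique-⊆⇒length≤ : ∀ {xs ys : List A} → Unique xs → xs ⊆ ys → length xs ≤ length ys
  Unique-⊆⇒length≤ {[]}     _                  _     = z≤n
  Unique-⊆⇒length≤ {x ∷ xs} {ys} (x∉xs ∷ xs!) xs⊆ys = begin
    suc (length xs)          ≤⟨ s≤s (Unique-⊆⇒length≤ xs! xs⊆ys─x) ⟩
    suc (length (ys ─ x∈ys)) ≡⟨ sym (length-removeAt′ ys (index x∈ys)) ⟩
    length ys                ∎
    where
      open ≤-Reasoning
      x∈ys : x ∈ ys
      x∈ys = xs⊆ys (here refl)
      xs⊆ys─x : xs ⊆ ys ─ x∈ys
      xs⊆ys─x y∈xs = ∈-─⁺ x∈ys (xs⊆ys (there y∈xs)) (λ y≡x → All.lookup x∉xs y∈xs (sym y≡x))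

  Unique-⊆⇒length< : ∀ {xs ys : List A} {z} → Unique xs → xs ⊆ ys → z ∈ ys → z ∉ xs →
                     length xs < length ys
  Unique-⊆⇒length< {xs} xs! xs⊆ys z∈ys z∉xs =
    Unique-⊆⇒length≤ (¬Any⇒All¬ xs z∉xs ∷ xs!) λ { (here refl) → z∈ys ; (there y∈xs) → xs⊆ys y∈xs }

  length-filter+filter-∁ : ∀ {p} {P : Pred A p} (P? : Decidable P) xs →
                           length xs ≡ length (filter P? xs) + length (filter (∁? P?) xs)
  length-filter+filter-∁ P? [] = refl
  length-filter+filter-∁ P? (x ∷ xs) with P? x
  ... | yes _ = cong suc (length-filter+filter-∁ P? xs)
  ... | no  _ = trans (cong suc (length-filter+filter-∁ P? xs)) (sym (+-suc _ _))

module ListIntersection {a} {A : Set a} (_≟ᴬ_ : DecidableEquality A) where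

  open DecMembership _≟ᴬ_ public using (_∈?_)

  infixl 6 _∩_ _∖_

  _∩_ : List A → List A → List A
  xs ∩ ys = filter (_∈? ys) xs

  _∖_ : List A → List A → List A
  xs ∖ ys = filter (∁? (_∈? ys)) xs

  length-∩+∖ : ∀ xs ys → length xs ≡ length (xs ∩ ys) + length (xs ∖ ys)
  length-∩+∖ xs ys = length-filter+filter-∁ (_∈? ys) xs

  ∩-⊆-∖ : ∀ {xs zs} ys → (∀ {x} → x ∈ xs → x ∉ zs) → xs ∩ ys ⊆ ys ∖ zs
  ∩-⊆-∖ ys xs∉zs x∈ = let x∈xs , x∈ys = ∈-filter⁻ (_∈? ys) x∈ in ∈-filter⁺ _ x∈ys (xs∉zs x∈xs)

  ∩-⊆ : ∀ xs ys → xs ∩ ys ⊆ ys ∩ xs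
  ∩-⊆ xs ys x∈ = let x∈xs , x∈ys = ∈-filter⁻ (_∈? ys) x∈ in ∈-filter⁺ (_∈? xs) x∈ys x∈xs

  length-∩-comm : ∀ {xs ys} → Unique xs → Unique ys → length (xs ∩ ys) ≡ length (ys ∩ xs)
  length-∩-comm {xs} {ys} xs! ys! = ≤-antisym
    (Unique-⊆⇒length≤ (Unique.filter⁺ (_∈? ys) xs!) (∩-⊆ xs ys))
    (Unique-⊆⇒length≤ (Unique.filter⁺ (_∈? xs) ys!) (∩-⊆ ys xs))

  length-∖-comm : ∀ {xs ys} → Unique xs → Unique ys → length xs ≡ length ys →
                  length (xs ∖ ys) ≡ length (ys ∖ xs)
  length-∖-comm {xs} {ys} xs! ys! |xs|≡|ys| = +-cancelˡ-≡ (length (xs ∩ ys)) _ _ (begin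
    length (xs ∩ ys) + length (xs ∖ ys) ≡⟨ sym (length-∩+∖ xs ys) ⟩
    length xs                           ≡⟨ |xs|≡|ys| ⟩
    length ys                           ≡⟨ length-∩+∖ ys xs ⟩
    length (ys ∩ xs) + length (ys ∖ xs) ≡⟨ cong (_+ length (ys ∖ xs)) (sym (length-∩-comm xs! ys!)) ⟩
    length (xs ∩ ys) + length (ys ∖ xs) ∎)
    where open ≡-Reasoning

module _ {n : ℕ} where

  infix 4 _∈ᵉ_

  _∈ᵉ_ : Fin n → Edge n → Set
  x ∈ᵉ (i , j) = x ≡ i ⊎ x ≡ j

  _∈ᵉ?_ : ∀ x e → Dec (x ∈ᵉ e)
  x ∈ᵉ? (i , j) = (x ≟ i) ⊎-dec (x ≟ j)

  Disjoint⇒¬common : ∀ {x f g} → Disjoint f g → x ∈ᵉ f → ¬ x ∈ᵉ g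
  Disjoint⇒¬common (i≢k , _ , _ , _) (inj₁ refl) (inj₁ refl) = i≢k refl
  Disjoint⇒¬common (_ , i≢l , _ , _) (inj₁ refl) (inj₂ refl) = i≢l refl
  Disjoint⇒¬common (_ , _ , j≢k , _) (inj₂ refl) (inj₁ refl) = j≢k refl
  Disjoint⇒¬common (_ , _ , _ , j≢l) (inj₂ refl) (inj₂ refl) = j≢l refl

  ¬common⇒Disjoint : ∀ {f g} → (∀ {x} → x ∈ᵉ f → ¬ x ∈ᵉ g) → Disjoint f g
  ¬common⇒Disjoint {i , j} ¬common =
    (λ i≡k → ¬common (inj₁ refl) (inj₁ i≡k)) , (λ i≡l → ¬common (inj₁ refl) (inj₂ i≡l)) ,
    (λ j≡k → ¬common (inj₂ refl) (inj₁ j≡k)) , (λ j≡l → ¬common (inj₂ refl) (inj₂ j≡l))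

  Disjoint⇒≢ : ∀ {f g : Edge n} → Disjoint f g → f ≢ g
  Disjoint⇒≢ (i≢k , _) f≡g = i≢k (cong proj₁ f≡g)

  ∈ᵉ-three-distinct : ∀ {x y z e} → x ∈ᵉ e → y ∈ᵉ e → z ∈ᵉ e → x ≢ y → x ≢ z → y ≢ z → ⊥
  ∈ᵉ-three-distinct (inj₁ refl) (inj₁ refl) _           x≢y _   _   = x≢y refl
  ∈ᵉ-three-distinct (inj₂ refl) (inj₂ refl) _           x≢y _   _   = x≢y refl
  ∈ᵉ-three-distinct (inj₁ refl) (inj₂ refl) (inj₁ refl) _   x≢z _   = x≢z refl
  ∈ᵉ-three-distinct (inj₁ refl) (inj₂ refl) (inj₂ refl) _   _   y≢z = y≢z refl
  ∈ᵉ-three-distinct (inj₂ refl) (inj₁ refl) (inj₁ refl) _   _   y≢z = y≢z refl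
  ∈ᵉ-three-distinct (inj₂ refl) (inj₁ refl) (inj₂ refl) _   x≢z _   = x≢z refl

  Joins : Edge n → Fin n → Fin n → Set
  Joins g i j = g ≡ (i , j) ⊎ g ≡ (j , i)

  Joins-∈ᵉˡ : ∀ {g i j} → Joins g i j → i ∈ᵉ g
  Joins-∈ᵉˡ (inj₁ refl) = inj₁ refl
  Joins-∈ᵉˡ (inj₂ refl) = inj₂ refl

  Joins-∈ᵉʳ : ∀ {g i j} → Joins g i j → j ∈ᵉ g
  Joins-∈ᵉʳ (inj₁ refl) = inj₂ refl
  Joins-∈ᵉʳ (inj₂ refl) = inj₁ refl

  Joins-∈ᵉ⁻ : ∀ {g i j x} → Joins g i j → x ∈ᵉ g → x ≡ i ⊎ x ≡ j
  Joins-∈ᵉ⁻ (inj₁ refl) x∈g         = x∈g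
  Joins-∈ᵉ⁻ (inj₂ refl) (inj₁ x≡j) = inj₂ x≡j
  Joins-∈ᵉ⁻ (inj₂ refl) (inj₂ x≡i) = inj₁ x≡i

  Disjoint-pairs⇒Unique : ∀ {X : List (Edge n)} → AllPairs Disjoint X → Unique X
  Disjoint-pairs⇒Unique = AllPairs.map Disjoint⇒≢

  Disjoint-pairs-common⇒≡ : ∀ {X f g x} → AllPairs Disjoint X → f ∈ X → g ∈ X →
                            x ∈ᵉ f → x ∈ᵉ g → f ≡ g
  Disjoint-pairs-common⇒≡ (_ ∷ _)  (here refl) (here refl) _ _ = refl
  Disjoint-pairs-common⇒≡ (f# ∷ _) (here refl) (there g∈)  x∈f x∈g =
    contradiction x∈g (Disjoint⇒¬common (All.lookup f# g∈) x∈f)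
  Disjoint-pairs-common⇒≡ (g# ∷ _) (there f∈)  (here refl) x∈f x∈g =
    contradiction x∈f (Disjoint⇒¬common (All.lookup g# f∈) x∈g)
  Disjoint-pairs-common⇒≡ (_ ∷ X#) (there f∈)  (there g∈)  x∈f x∈g =
    Disjoint-pairs-common⇒≡ X# f∈ g∈ x∈f x∈g

  _≟ᵉ_ : DecidableEquality (Edge n)
  _≟ᵉ_ = ≡-dec _≟_ _≟_

  open ListIntersection _≟ᵉ_ public

module _ {n : ℕ} (K : Graph n) where

  ∷-isMatching : ∀ {X g} → IsMatching K X → IsEdge K g → (∀ {f} → f ∈ X → Disjoint g f) →
                 IsMatching K (g ∷ X)
  ∷-isMatching (X⊆E , X#) g∈E g#X = (g∈E ∷ X⊆E) , (All.tabulate g#X ∷ X#)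

  length≤ν : ∀ {X b} → HasMatchingNumber K b → IsMatching K X → length X ≤ b
  length≤ν {X} (M , (_ , M-max) , |M|≡b) X-matching = subst (length X ≤_) |M|≡b (M-max X X-matching)

module _ {n : ℕ} (G : Graph n) where

  deleteEdges-isEdge : ∀ {F e} → All (IsEdge G) F → IsEdge G e → e ∉ F → IsEdge (deleteEdges G F) e
  deleteEdges-isEdge F⊆E (i<j , adj) e∉F =
    i<j , adj , e∉F , λ ji∈F → <-asym i<j (proj₁ (All.lookup F⊆E ji∈F))

  deleteEdges-∉ : ∀ {F e} → IsEdge (deleteEdges G F) e → e ∉ F
  deleteEdges-∉ (_ , _ , e∉F , _) = e∉F

  deleteEdges-isMatching⁻ : ∀ {F X} → IsMatching (deleteEdges G F) X → IsMatching G X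
  deleteEdges-isMatching⁻ (X⊆E , X#) = All.map (λ (i<j , adj , _) → i<j , adj) X⊆E , X#

  ∖-isMatching : ∀ {X F} → IsMatching G X → All (IsEdge G) F → IsMatching (deleteEdges G F) (X ∖ F)
  ∖-isMatching {X} {F} (X⊆E , X#) F⊆E =
    All.tabulate (λ e∈ → let e∈X , e∉F = ∈-filter⁻ _ {xs = X} e∈ in
                         deleteEdges-isEdge F⊆E (All.lookup X⊆E e∈X) e∉F) ,
    AllPairs.filter⁺ _ X#

  Adj⇒≢ : ∀ {i j} → Adj G i j → i ≢ j
  Adj⇒≢ {i} adj i≡j = irrefl G i (subst (Adj G i) (sym i≡j) adj)

  edge-joining : ∀ {i j} → Adj G i j → Σ (Edge n) λ g → IsEdge G g × Joins g i j
  edge-joining {i} {j} adj with <-cmp (toℕ i) (toℕ j)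
  ... | tri< i<j _ _ = (i , j) , (i<j , adj) , inj₁ refl
  ... | tri≈ _ i≡j _ = contradiction (toℕ-injective i≡j) (Adj⇒≢ adj)
  ... | tri> _ _ j<i = (j , i) , (j<i , Graph.sym G adj) , inj₂ refl

  pendant-neighbour-unique : ∀ {p y w} → degree G p ≡ 1 → Adj G p y → Adj G p w → y ≡ w
  pendant-neighbour-unique {p} {y} {w} deg≡1 adj-y adj-w with y ≟ w
  ... | yes y≡w = y≡w
  ... | no  y≢w = contradiction (subst (2 ≤_) deg≡1 two≤deg) λ { (s≤s ()) }
    where
      two≤deg : 2 ≤ degree G p
      two≤deg = Unique-⊆⇒length≤ ((y≢w ∷ []) ∷ [] ∷ []) λ
        { (here refl)         → ∈-filter⁺ (adj? G p) (∈-allFin y) adj-y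
        ; (there (here refl)) → ∈-filter⁺ (adj? G p) (∈-allFin w) adj-w }

  pendant-edge-∈ᵉ : ∀ {p w f} → degree G p ≡ 1 → Adj G p w → IsEdge G f → p ∈ᵉ f → w ∈ᵉ f
  pendant-edge-∈ᵉ deg≡1 adj-w (_ , adj) (inj₁ refl) = inj₂ (sym (pendant-neighbour-unique deg≡1 adj adj-w))
  pendant-edge-∈ᵉ deg≡1 adj-w (_ , adj) (inj₂ refl) =
    inj₁ (sym (pendant-neighbour-unique deg≡1 (Graph.sym G adj) adj-w))

  -- Edges avoiding w also avoid the pendant p, so the edge pw can be added to them.
  pendant-∷-isMatching : ∀ (K : Graph n) {p w g X} → degree G p ≡ 1 → Adj G p w → Joins g p w →
                         IsMatching K X → All (IsEdge G) X → (∀ {f} → f ∈ X → ¬ w ∈ᵉ f) →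
                         IsEdge K g → IsMatching K (g ∷ X)
  pendant-∷-isMatching K {g = g} {X = X} deg≡1 adj-w joins X-matching X⊆E X-avoids-w g∈E =
    ∷-isMatching K X-matching g∈E λ f∈X → ¬common⇒Disjoint (¬common f∈X)
    where
      ¬common : ∀ {f x} → f ∈ X → x ∈ᵉ g → ¬ x ∈ᵉ f
      ¬common f∈X x∈g x∈f with Joins-∈ᵉ⁻ joins x∈g
      ... | inj₁ refl = X-avoids-w f∈X (pendant-edge-∈ᵉ deg≡1 adj-w (All.lookup X⊆E f∈X) x∈f)
      ... | inj₂ refl = X-avoids-w f∈X x∈f

  maximum-matching-covers-pendant-neighbour : ∀ {F p w} → IsMaximumMatching G F →
    degree G p ≡ 1 → Adj G p w → Any (w ∈ᵉ_) F
  maximum-matching-covers-pendant-neighbour {F} {w = w} (F-matching , F-max) deg≡1 adj-w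
    with any? (w ∈ᵉ?_) F | edge-joining adj-w
  ... | yes covered  | _ = covered
  ... | no ¬covered | g , g∈E , joins = contradiction (F-max (g ∷ F) F+g-matching) (<-irrefl refl)
    where
      F+g-matching : IsMatching G (g ∷ F)
      F+g-matching = pendant-∷-isMatching G deg≡1 adj-w joins F-matching (proj₁ F-matching)
                       (λ f∈F w∈f → ¬covered (lose f∈F w∈f)) g∈E

  -- With b = ν(G \ F): deleting F from any matching of G through e leaves a matching of
  -- G \ F that is not maximum.
  Deficient : List (Edge n) → ℕ → Edge n → Set
  Deficient F b e = ∀ {Y} → IsMatching G Y → e ∈ Y → length (Y ∖ F) < b

  pendant-cover-deficient : ∀ {F b p w e} → IsMatching G F → HasMatchingNumber (deleteEdges G F) b →
    degree G p ≡ 1 → Adj G p w → e ∈ F → w ∈ᵉ e → ¬ p ∈ᵉ e → Deficient F b e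
  pendant-cover-deficient {F} {p = p} {w} (F⊆E , F#) ν≡b deg≡1 adj-w e∈F w∈e p∉e {Y} Y-matching e∈Y
    with edge-joining adj-w
  ... | g , g∈E , joins = length≤ν (deleteEdges G F) ν≡b
          (pendant-∷-isMatching (deleteEdges G F) deg≡1 adj-w joins Y∖F-matching
             (proj₁ (deleteEdges-isMatching⁻ Y∖F-matching)) Y∖F-avoids-w (deleteEdges-isEdge F⊆E g∈E g∉F))
    where
      Y∖F-matching : IsMatching (deleteEdges G F) (Y ∖ F)
      Y∖F-matching = ∖-isMatching Y-matching F⊆E

      Y∖F-avoids-w : ∀ {f} → f ∈ Y ∖ F → ¬ w ∈ᵉ f
      Y∖F-avoids-w f∈ w∈f = let f∈Y , f∉F = ∈-filter⁻ _ {xs = Y} f∈ in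
        f∉F (subst (_∈ F) (Disjoint-pairs-common⇒≡ (proj₂ Y-matching) e∈Y f∈Y w∈e w∈f) e∈F)

      g∉F : g ∉ F
      g∉F g∈F = p∉e (subst (p ∈ᵉ_) (Disjoint-pairs-common⇒≡ F# g∈F e∈F (Joins-∈ᵉʳ joins) w∈e)
                                    (Joins-∈ᵉˡ joins))

  twin-pendants⇒deficient-edge : ∀ {F b u v w} → IsMaximumMatching G F →
    HasMatchingNumber (deleteEdges G F) b → u ≢ v → degree G u ≡ 1 → degree G v ≡ 1 →
    Adj G u w → Adj G v w → ∃ λ e → e ∈ F × Deficient F b e
  twin-pendants⇒deficient-edge {u = u} F-max ν≡b u≢v deg-u deg-v adj-u adj-v
    with find (maximum-matching-covers-pendant-neighbour F-max deg-u adj-u)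
  ... | e , e∈F , w∈e with u ∈ᵉ? e
  ... | no  u∉e = e , e∈F , pendant-cover-deficient (proj₁ F-max) ν≡b deg-u adj-u e∈F w∈e u∉e
  ... | yes u∈e = e , e∈F , pendant-cover-deficient (proj₁ F-max) ν≡b deg-v adj-v e∈F w∈e
                    λ v∈e → ∈ᵉ-three-distinct u∈e v∈e w∈e u≢v (Adj⇒≢ adj-u) (Adj⇒≢ adj-v)

  deficient-edge⇒length<2*ν : ∀ {F F′ H b e} → IsMaximumMatching G F →
    HasMatchingNumber (deleteEdges G F) b → IsMaximumMatching G F′ →
    IsMatching (deleteEdges G F′) H → e ∈ F → Deficient F b e → length H < 2 * b
  deficient-edge⇒length<2*ν {F} {F′} {H} {b} {e} (F-matching , F-max) ν≡b (F′-matching , F′-max)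
    H-matching e∈F deficient = begin-strict
      length H                        ≡⟨ length-∩+∖ H F ⟩
      length (H ∩ F) + length (H ∖ F) <⟨ split-bound ⟩
      b + b                           ≡⟨ cong (b +_) (sym (+-identityʳ b)) ⟩
      2 * b                           ∎
    where
      open ≤-Reasoning
      H-matchingᴳ : IsMatching G H
      H-matchingᴳ = deleteEdges-isMatching⁻ H-matching

      H∖F≤b : length (H ∖ F) ≤ b
      H∖F≤b = length≤ν (deleteEdges G F) ν≡b (∖-isMatching H-matchingᴳ (proj₁ F-matching))

      F′∖F≤b : length (F′ ∖ F) ≤ b
      F′∖F≤b = length≤ν (deleteEdges G F) ν≡b (∖-isMatching F′-matching (proj₁ F-matching))

      |F∖F′|≡|F′∖F| : length (F ∖ F′) ≡ length (F′ ∖ F)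
      |F∖F′|≡|F′∖F| = length-∖-comm (Disjoint-pairs⇒Unique (proj₂ F-matching))
                        (Disjoint-pairs⇒Unique (proj₂ F′-matching))
                        (≤-antisym (F′-max F F-matching) (F-max F′ F′-matching))

      H∩F⊆F∖F′ : H ∩ F ⊆ F ∖ F′
      H∩F⊆F∖F′ = ∩-⊆-∖ F (λ e∈H → deleteEdges-∉ (All.lookup (proj₁ H-matching) e∈H))

      H∩F-unique : Unique (H ∩ F)
      H∩F-unique = Unique.filter⁺ (_∈? F) (Disjoint-pairs⇒Unique (proj₂ H-matching))

      H∩F≤F′∖F : length (H ∩ F) ≤ length (F′ ∖ F)
      H∩F≤F′∖F = subst (length (H ∩ F) ≤_) |F∖F′|≡|F′∖F| (Unique-⊆⇒length≤ H∩F-unique H∩F⊆F∖F′)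

      H∩F<F′∖F : e ∉ F′ → e ∉ H → length (H ∩ F) < length (F′ ∖ F)
      H∩F<F′∖F e∉F′ e∉H = subst (length (H ∩ F) <_) |F∖F′|≡|F′∖F|
        (Unique-⊆⇒length< H∩F-unique H∩F⊆F∖F′ (∈-filter⁺ _ e∈F e∉F′)
          (λ e∈H∩F → e∉H (proj₁ (∈-filter⁻ _ {xs = H} e∈H∩F))))

      split-bound : length (H ∩ F) + length (H ∖ F) < b + b
      split-bound with e ∈? F′ | e ∈? H
      ... | yes e∈F′ | _       = +-mono-<-≤ (≤-<-trans H∩F≤F′∖F (deficient F′-matching e∈F′)) H∖F≤b
      ... | no  _    | yes e∈H = +-mono-≤-< (≤-trans H∩F≤F′∖F F′∖F≤b) (deficient H-matchingᴳ e∈H)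
      ... | no  e∉F′ | no  e∉H = +-mono-<-≤ (<-≤-trans (H∩F<F′∖F e∉F′ e∉H) F′∖F≤b) H∖F≤b

corollary1 : (n : ℕ) (G : Graph n) →
    (Σ ℕ λ a → Σ ℕ λ b → HasL G a × Hasl G b × a ≡ 2 * b) →
    ¬ (Σ (Fin n) λ u → Σ (Fin n) λ v → Σ (Fin n) λ w →
         u ≢ v × degree G u ≡ 1 × degree G v ≡ 1 × Adj G u w × Adj G v w)
corollary1 n G (a , b , ((F′ , F′-max , H , (H-matching , _) , |H|≡a) , _) , ((F , F-max , ν≡b) , _) , a≡2b)
               (u , v , w , u≢v , deg-u , deg-v , adj-u , adj-v) =
  let e , e∈F , deficient = twin-pendants⇒deficient-edge G F-max ν≡b u≢v deg-u deg-v adj-u adj-v in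
  <-irrefl (trans |H|≡a a≡2b) (deficient-edge⇒length<2*ν G F-max ν≡b F′-max H-matching e∈F deficient)
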